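{- Let $g(x),f(x)$ be formal power series with integer coefficients and $g(0)=f(0)=1$, let $A=(g(x),xf(x))$ be the corresponding Riordan array with entries $a_{n,k}=[x^n]g(x)(xf(x))^k$, and let $\phi(x)$ be the reversion of $x/f(x)$. Let $c(A;1)$ be the infinite lower-triangular matrix whose $(n,k)$ entry is $a_{2n,n+k}$ ($n,k\ge 0$). Then $c(A;1)$ is a Riordan array, and $$c(A;1)=\left(\frac{\phi'(x)}{f(\phi(x))},\ \phi(x)\right)\cdot A,$$ where $\phi'=\frac{d}{dx}\phi$.
   Context: A Riordan array $(d(x),h(x))$, for formal power series $d,h$ with $d(0)\neq 0$, $h(0)=0$, $h'(0)\neq 0$, is the infinite lower-triangular matrix whose $(n,k)$ entry ($n,k\ge0$) is $[x^n]d(x)h(x)^k$, where $[x^n]$ extracts the coefficient of $x^n$. Riordan arrays form a group under matrix multiplication, with $(d,h)\cdot(u,w)=(d(x)u(h(x)),\,w(h(x)))$ and $(d,h)^{ -1}=(1/d(\bar h(x)),\bar h(x))$. For a power series $h$ with $h(0)=0$, $h'(0)\ne0$, its reversion $\bar h$ (also written $\mathrm{Rev}(h)$) is the unique power series $u$ with $u(0)=0$ and $h(u(x))=x$. -}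

module Defs where

open import Data.Nat using (ℕ; zero; suc; _∸_; _≟_)
open import Data.Integer using (ℤ; +_; _+_; _*_; -_)
open import Relation.Nullary using (yes; no)
open import Relation.Binary.PropositionalEquality using (_≡_)
open import Data.Product using (_×_)

FPS : Set
FPS = ℕ → ℤ

sumTo : ℕ → (ℕ → ℤ) → ℤ
sumTo zero    t = t zero
sumTo (suc n) t = sumTo n t + t (suc n)

sum1To : ℕ → (ℕ → ℤ) → ℤ
sum1To zero    t = + 0
sum1To (suc n) t = sum1To n t + t (suc n)

one : FPS
one zero    = + 1
one (suc _) = + 0

X : FPS
X zero          = + 0
X (suc zero)    = + 1
X (suc (suc _)) = + 0

_⊛_ : FPS → FPS → FPS
(a ⊛ b) n = sumTo n (λ i → a i * b (n ∸ i))

infixl 7 _⊛_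

pow : FPS → ℕ → FPS
pow a zero    = one
pow a (suc k) = a ⊛ pow a k

-- composition a(b(x)), meaningful when b 0 ≡ 0:
-- [x^n] a(b(x)) = Σ_{k=0}^{n} a_k [x^n] b(x)^k
_∘ₛ_ : FPS → FPS → FPS
(a ∘ₛ b) n = sumTo n (λ k → a k * pow b k n)

deriv : FPS → FPS
deriv a n = + (suc n) * a (suc n)

-- Multiplicative inverse of a series with constant term 1 (the only case used):
-- b_0 = 1, b_m = - Σ_{j=1}^{m} a_j b_{m-j}.
-- invUpTo a n is correct on indices ≤ n.
invUpTo : FPS → ℕ → FPS
invUpTo a zero    = one
invUpTo a (suc n) i with i ≟ suc n
... | yes _ = - sum1To (suc n) (λ j → a j * invUpTo a n (suc n ∸ j))
... | no  _ = invUpTo a n i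

inv : FPS → FPS
inv a n = invUpTo a n n

IsReversionOf : FPS → FPS → Set
IsReversionOf u h = (u 0 ≡ + 0) × (∀ n → (h ∘ₛ u) n ≡ X n)

riordan : FPS → FPS → ℕ → ℕ → ℤ
riordan d h n k = (d ⊛ pow h k) n

-- Product of lower-triangular ℕ×ℕ matrices (entries with j > n vanish)
matMul : (ℕ → ℕ → ℤ) → (ℕ → ℕ → ℤ) → ℕ → ℕ → ℤ
matMul L M n k = sumTo n (λ j → L n j * M j k)

-- Put F = f(φ) and D = φ′/F. From (x/f)(φ) = x we get φ = x F, and differentiating gives
-- D = 1 + x f′(φ) D. With these two identities the entries [x^n] D φ^m satisfy the same
-- recurrences in n as [x^n] x^m f^n (for the first column this uses the power rule
-- [x^(n+1)] f^(n+1) = [x^n] f′ f^n), which is Lagrange inversion. Now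
-- a_{2n,n+k} = [x^(2n)] x^n f^n · g (xf)^k = Σ_j [x^(n-j)] f^n · a_{j,k} and
-- [x^(n-j)] f^n = [x^n] D φ^j, so c(A;1) = (D, φ) · A; the fundamental theorem of Riordan
-- arrays evaluates this product to the Riordan array (D · g(φ), x f(φ)).
module Submission where

open import Defs
open import Data.Integer using (ℤ; +_)
open import Relation.Binary.PropositionalEquality using (_≡_; _≢_; _≗_; refl; sym; trans)

module PowerSeries where

  open import Data.Nat using (ℕ; zero; suc; _∸_; _≤_; _<_; z≤n; s≤s; _≟_) renaming (_+_ to _+ℕ_)
  open import Data.Nat.Properties
    using (≤-refl; ≤-trans; ≤-pred; m≤n⇒m≤1+n; ≤∧≢⇒<; <⇒≢; m≤m+n; m∸n≤m; m∸[m∸n]≡n; m+[n∸m]≡n;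
           +-∸-assoc; ∸-+-assoc; n∸n≡0; +-identityʳ; +-suc; +-monoʳ-<; m≤n⇒∃[o]m+o≡n)
  open import Data.Integer using (-_; _+_; _*_)
  open import Data.Integer.Properties
    using (+-identityˡ; *-identityˡ; *-identityʳ; *-zeroˡ; *-zeroʳ; *-distribˡ-+; *-comm; *-assoc;
           *-cancelˡ-≡; pos-+)
    renaming (+-identityʳ to +ℤ-identityʳ; +-assoc to +ℤ-assoc; +-comm to +ℤ-comm)
  open import Data.Integer.Tactic.RingSolver using (solve-∀)
  open import Data.Empty using (⊥-elim)
  open import Data.Product using (_,_)
  open import Relation.Nullary using (yes; no)
  open import Relation.Binary using (Setoid)
  open import Relation.Binary.PropositionalEquality
  import Relation.Binary.Reasoning.Setoid as SetoidReasoning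

  sumTo-cong : ∀ n {s t : ℕ → ℤ} → (∀ i → i ≤ n → s i ≡ t i) → sumTo n s ≡ sumTo n t
  sumTo-cong zero    s≡t = s≡t 0 z≤n
  sumTo-cong (suc n) s≡t =
    cong₂ _+_ (sumTo-cong n (λ i i≤n → s≡t i (m≤n⇒m≤1+n i≤n))) (s≡t (suc n) ≤-refl)

  sumTo-zero : ∀ n {t : ℕ → ℤ} → (∀ i → i ≤ n → t i ≡ + 0) → sumTo n t ≡ + 0
  sumTo-zero zero    t≡0 = t≡0 0 z≤n
  sumTo-zero (suc n) t≡0 =
    cong₂ _+_ (sumTo-zero n (λ i i≤n → t≡0 i (m≤n⇒m≤1+n i≤n))) (t≡0 (suc n) ≤-refl)

  sumTo-+ : ∀ n (s t : ℕ → ℤ) → sumTo n (λ i → s i + t i) ≡ sumTo n s + sumTo n t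
  sumTo-+ zero    s t = refl
  sumTo-+ (suc n) s t =
    trans (cong (_+ (s (suc n) + t (suc n))) (sumTo-+ n s t)) (swap-middle (sumTo n s) (sumTo n t) (s (suc n)) (t (suc n)))
    where
    swap-middle : ∀ a b c d → (a + b) + (c + d) ≡ (a + c) + (b + d)
    swap-middle = solve-∀

  *-distribˡ-sumTo : ∀ n c (t : ℕ → ℤ) → c * sumTo n t ≡ sumTo n (λ i → c * t i)
  *-distribˡ-sumTo zero    c t = refl
  *-distribˡ-sumTo (suc n) c t =
    trans (*-distribˡ-+ c (sumTo n t) (t (suc n))) (cong (_+ c * t (suc n)) (*-distribˡ-sumTo n c t))

  *-distribʳ-sumTo : ∀ n c (t : ℕ → ℤ) → sumTo n t * c ≡ sumTo n (λ i → t i * c)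
  *-distribʳ-sumTo n c t =
    trans (*-comm (sumTo n t) c)
          (trans (*-distribˡ-sumTo n c t) (sumTo-cong n (λ i _ → *-comm c (t i))))

  sumTo-head : ∀ n (t : ℕ → ℤ) → sumTo (suc n) t ≡ t 0 + sumTo n (λ i → t (suc i))
  sumTo-head zero    t = refl
  sumTo-head (suc n) t = trans (cong (_+ t (suc (suc n))) (sumTo-head n t)) (+ℤ-assoc (t 0) _ _)

  sumTo≡head+sum1To : ∀ n (t : ℕ → ℤ) → sumTo n t ≡ t 0 + sum1To n t
  sumTo≡head+sum1To zero    t = sym (+ℤ-identityʳ _)
  sumTo≡head+sum1To (suc n) t =
    trans (cong (_+ t (suc n)) (sumTo≡head+sum1To n t)) (+ℤ-assoc (t 0) _ _)

  sum1To-cong : ∀ n {s t : ℕ → ℤ} → (∀ i → i < n → s (suc i) ≡ t (suc i)) → sum1To n s ≡ sum1To n t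
  sum1To-cong zero    s≡t = refl
  sum1To-cong (suc n) s≡t =
    cong₂ _+_ (sum1To-cong n (λ i i<n → s≡t i (m≤n⇒m≤1+n i<n))) (s≡t n ≤-refl)

  sumTo-extend : ∀ n N (t : ℕ → ℤ) → n ≤ N → (∀ i → n < i → t i ≡ + 0) → sumTo N t ≡ sumTo n t
  sumTo-extend n N t n≤N t≡0 with m≤n⇒∃[o]m+o≡n n≤N
  ... | o , refl = extend o
    where
    extend : ∀ o → sumTo (n +ℕ o) t ≡ sumTo n t
    extend zero    = cong (λ m → sumTo m t) (+-identityʳ n)
    extend (suc o) rewrite +-suc n o =
      trans (cong₂ _+_ (extend o) (t≡0 (suc (n +ℕ o)) (s≤s (m≤m+n n o)))) (+ℤ-identityʳ _)

  sumTo-single : ∀ n k (t : ℕ → ℤ) → k ≤ n → (∀ i → i ≢ k → t i ≡ + 0) → sumTo n t ≡ t k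
  sumTo-single zero    .zero t z≤n t≡0 = refl
  sumTo-single (suc n) k     t k≤n t≡0 with k ≟ suc n
  ... | yes refl =
    trans (cong (_+ t (suc n)) (sumTo-zero n (λ i i≤n → t≡0 i (<⇒≢ (s≤s i≤n))))) (+-identityˡ _)
  ... | no k≢n =
    trans (cong₂ _+_ (sumTo-single n k t (≤-pred (≤∧≢⇒< k≤n k≢n)) t≡0)
                     (t≡0 (suc n) (λ n≡k → k≢n (sym n≡k))))
          (+ℤ-identityʳ _)

  sumTo-comm : ∀ n m (t : ℕ → ℕ → ℤ) →
    sumTo n (λ i → sumTo m (λ j → t i j)) ≡ sumTo m (λ j → sumTo n (λ i → t i j))
  sumTo-comm zero    m t = refl
  sumTo-comm (suc n) m t =
    trans (cong (_+ sumTo m (t (suc n))) (sumTo-comm n m t))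
          (sym (sumTo-+ m (λ j → sumTo n (λ i → t i j)) (t (suc n))))

  sumTo-reverse : ∀ n (t : ℕ → ℤ) → sumTo n (λ i → t (n ∸ i)) ≡ sumTo n t
  sumTo-reverse zero    t = refl
  sumTo-reverse (suc n) t = begin
      sumTo n (λ i → t (suc n ∸ i)) + t (n ∸ n)
    ≡⟨ cong₂ _+_ (sumTo-cong n (λ i i≤n → cong t (+-∸-assoc 1 i≤n))) (cong t (n∸n≡0 n)) ⟩
      sumTo n (λ i → t (suc (n ∸ i))) + t 0
    ≡⟨ cong (_+ t 0) (sumTo-reverse n (λ i → t (suc i))) ⟩
      sumTo n (λ i → t (suc i)) + t 0
    ≡⟨ +ℤ-comm _ (t 0) ⟩
      t 0 + sumTo n (λ i → t (suc i))
    ≡⟨ sym (sumTo-head n t) ⟩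
      sumTo (suc n) t ∎
    where open ≡-Reasoning

  sumTo-triangle : ∀ n (t : ℕ → ℕ → ℤ) →
    sumTo n (λ k → sumTo k (λ i → t i (k ∸ i))) ≡ sumTo n (λ i → sumTo (n ∸ i) (λ j → t i j))
  sumTo-triangle zero    t = refl
  sumTo-triangle (suc n) t = begin
      sumTo n (λ k → sumTo k (λ i → t i (k ∸ i))) + sumTo (suc n) (λ i → t i (suc n ∸ i))
    ≡⟨ cong (_+ sumTo (suc n) (λ i → t i (suc n ∸ i))) (sumTo-triangle n t) ⟩
      sumTo n (λ i → sumTo (n ∸ i) (t i)) + (sumTo n (λ i → t i (suc n ∸ i)) + t (suc n) (n ∸ n))
    ≡⟨ sym (+ℤ-assoc (sumTo n (λ i → sumTo (n ∸ i) (t i))) _ _) ⟩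
      (sumTo n (λ i → sumTo (n ∸ i) (t i)) + sumTo n (λ i → t i (suc n ∸ i))) + t (suc n) (n ∸ n)
    ≡⟨ cong (_+ t (suc n) (n ∸ n)) (sym (sumTo-+ n _ _)) ⟩
      sumTo n (λ i → sumTo (n ∸ i) (t i) + t i (suc n ∸ i)) + t (suc n) (n ∸ n)
    ≡⟨ cong₂ _+_ (sumTo-cong n row-grows) (last-row (n ∸ n) (n∸n≡0 n)) ⟩
      sumTo (suc n) (λ i → sumTo (suc n ∸ i) (t i)) ∎
    where
    open ≡-Reasoning
    row-grows : ∀ i → i ≤ n → sumTo (n ∸ i) (t i) + t i (suc n ∸ i) ≡ sumTo (suc n ∸ i) (t i)
    row-grows i i≤n rewrite +-∸-assoc 1 i≤n = refl
    last-row : ∀ m → m ≡ 0 → t (suc n) m ≡ sumTo m (t (suc n))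
    last-row .0 refl = refl

  -- The ring of formal power series, up to pointwise equality _≗_

  open Setoid (ℕ →-setoid ℤ) public using () renaming (refl to ≗-refl; sym to ≗-sym; trans to ≗-trans)
  module ≗-Reasoning = SetoidReasoning (ℕ →-setoid ℤ)

  infixl 6 _⊕_
  _⊕_ : FPS → FPS → FPS
  (a ⊕ b) n = a n + b n

  scale : ℤ → FPS → FPS
  scale c a n = c * a n

  ⊕-cong : ∀ {a a′ b b′} → a ≗ a′ → b ≗ b′ → a ⊕ b ≗ a′ ⊕ b′
  ⊕-cong a≗a′ b≗b′ n = cong₂ _+_ (a≗a′ n) (b≗b′ n)

  ⊛-cong : ∀ {a a′ b b′} → a ≗ a′ → b ≗ b′ → a ⊛ b ≗ a′ ⊛ b′
  ⊛-cong a≗a′ b≗b′ n = sumTo-cong n (λ i _ → cong₂ _*_ (a≗a′ i) (b≗b′ (n ∸ i)))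

  ⊛-congˡ : ∀ {a a′} b → a ≗ a′ → a ⊛ b ≗ a′ ⊛ b
  ⊛-congˡ b a≗a′ = ⊛-cong a≗a′ (≗-refl {b})

  ⊛-congʳ : ∀ a {b b′} → b ≗ b′ → a ⊛ b ≗ a ⊛ b′
  ⊛-congʳ a b≗b′ = ⊛-cong (≗-refl {a}) b≗b′

  ⊛-comm : ∀ a b → a ⊛ b ≗ b ⊛ a
  ⊛-comm a b n =
    trans (sym (sumTo-reverse n (λ i → a i * b (n ∸ i))))
          (sumTo-cong n (λ i i≤n → trans (cong (λ z → a (n ∸ i) * b z) (m∸[m∸n]≡n i≤n))
                                         (*-comm (a (n ∸ i)) (b i))))

  ⊛-assoc : ∀ a b c → (a ⊛ b) ⊛ c ≗ a ⊛ (b ⊛ c)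
  ⊛-assoc a b c n = begin
      sumTo n (λ k → sumTo k (λ i → a i * b (k ∸ i)) * c (n ∸ k))
    ≡⟨ sumTo-cong n (λ k _ → *-distribʳ-sumTo k (c (n ∸ k)) (λ i → a i * b (k ∸ i))) ⟩
      sumTo n (λ k → sumTo k (λ i → a i * b (k ∸ i) * c (n ∸ k)))
    ≡⟨ sumTo-cong n (λ k _ → sumTo-cong k (λ i i≤k → cong (λ z → a i * b (k ∸ i) * c z) (rest k i≤k))) ⟩
      sumTo n (λ k → sumTo k (λ i → a i * b (k ∸ i) * c (n ∸ i ∸ (k ∸ i))))
    ≡⟨ sumTo-triangle n (λ i j → a i * b j * c (n ∸ i ∸ j)) ⟩
      sumTo n (λ i → sumTo (n ∸ i) (λ j → a i * b j * c (n ∸ i ∸ j)))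
    ≡⟨ sumTo-cong n (λ i _ → trans (sumTo-cong (n ∸ i) (λ j _ → *-assoc (a i) (b j) _))
                                  (sym (*-distribˡ-sumTo (n ∸ i) (a i) _))) ⟩
      (a ⊛ (b ⊛ c)) n ∎
    where
    open ≡-Reasoning
    rest : ∀ k {i} → i ≤ k → n ∸ k ≡ n ∸ i ∸ (k ∸ i)
    rest k {i} i≤k = trans (cong (n ∸_) (sym (m+[n∸m]≡n i≤k))) (sym (∸-+-assoc n i (k ∸ i)))

  ⊛-distribˡ-⊕ : ∀ a b c → a ⊛ (b ⊕ c) ≗ a ⊛ b ⊕ a ⊛ c
  ⊛-distribˡ-⊕ a b c n =
    trans (sumTo-cong n (λ i _ → *-distribˡ-+ (a i) (b (n ∸ i)) (c (n ∸ i)))) (sumTo-+ n _ _)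

  ⊛-distribʳ-⊕ : ∀ a b c → (b ⊕ c) ⊛ a ≗ b ⊛ a ⊕ c ⊛ a
  ⊛-distribʳ-⊕ a b c = begin
    (b ⊕ c) ⊛ a    ≈⟨ ⊛-comm (b ⊕ c) a ⟩
    a ⊛ (b ⊕ c)    ≈⟨ ⊛-distribˡ-⊕ a b c ⟩
    a ⊛ b ⊕ a ⊛ c  ≈⟨ ⊕-cong (⊛-comm a b) (⊛-comm a c) ⟩
    b ⊛ a ⊕ c ⊛ a  ∎
    where open ≗-Reasoning

  scale-⊛ : ∀ s a b → scale s a ⊛ b ≗ scale s (a ⊛ b)
  scale-⊛ s a b n = trans (sumTo-cong n (λ i _ → *-assoc s (a i) (b (n ∸ i)))) (sym (*-distribˡ-sumTo n s _))

  ⊛-interchange : ∀ a b c d → (a ⊛ b) ⊛ (c ⊛ d) ≗ (a ⊛ c) ⊛ (b ⊛ d)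
  ⊛-interchange a b c d = begin
    (a ⊛ b) ⊛ (c ⊛ d)  ≈⟨ ⊛-assoc a b (c ⊛ d) ⟩
    a ⊛ (b ⊛ (c ⊛ d))  ≈⟨ ⊛-congʳ a (≗-sym (⊛-assoc b c d)) ⟩
    a ⊛ ((b ⊛ c) ⊛ d)  ≈⟨ ⊛-congʳ a (⊛-congˡ d (⊛-comm b c)) ⟩
    a ⊛ ((c ⊛ b) ⊛ d)  ≈⟨ ⊛-congʳ a (⊛-assoc c b d) ⟩
    a ⊛ (c ⊛ (b ⊛ d))  ≈⟨ ≗-sym (⊛-assoc a c (b ⊛ d)) ⟩
    (a ⊛ c) ⊛ (b ⊛ d)  ∎
    where open ≗-Reasoning

  ⊛-permute : ∀ a b c d → a ⊛ ((b ⊛ c) ⊛ d) ≗ b ⊛ ((a ⊛ d) ⊛ c)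
  ⊛-permute a b c d = begin
    a ⊛ ((b ⊛ c) ⊛ d)  ≈⟨ ⊛-congʳ a (⊛-assoc b c d) ⟩
    a ⊛ (b ⊛ (c ⊛ d))  ≈⟨ ≗-sym (⊛-assoc a b (c ⊛ d)) ⟩
    (a ⊛ b) ⊛ (c ⊛ d)  ≈⟨ ⊛-congˡ (c ⊛ d) (⊛-comm a b) ⟩
    (b ⊛ a) ⊛ (c ⊛ d)  ≈⟨ ⊛-congʳ (b ⊛ a) (⊛-comm c d) ⟩
    (b ⊛ a) ⊛ (d ⊛ c)  ≈⟨ ⊛-assoc b a (d ⊛ c) ⟩
    b ⊛ (a ⊛ (d ⊛ c))  ≈⟨ ⊛-congʳ b (≗-sym (⊛-assoc a d c)) ⟩
    b ⊛ ((a ⊛ d) ⊛ c)  ∎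
    where open ≗-Reasoning

  one-⊛ : ∀ a → one ⊛ a ≗ a
  one-⊛ a n = trans (sumTo-single n 0 _ z≤n only-0) (*-identityˡ _)
    where
    only-0 : ∀ i → i ≢ 0 → one i * a (n ∸ i) ≡ + 0
    only-0 zero    i≢0 = ⊥-elim (i≢0 refl)
    only-0 (suc i) i≢0 = refl

  ⊛-one : ∀ a → a ⊛ one ≗ a
  ⊛-one a = ≗-trans (⊛-comm a one) (one-⊛ a)

  X-⊛-suc : ∀ a n → (X ⊛ a) (suc n) ≡ a n
  X-⊛-suc a n = trans (sumTo-single (suc n) 1 _ (s≤s z≤n) only-1) (*-identityˡ _)
    where
    only-1 : ∀ i → i ≢ 1 → X i * a (suc n ∸ i) ≡ + 0
    only-1 zero          i≢1 = refl
    only-1 (suc zero)    i≢1 = ⊥-elim (i≢1 refl)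
    only-1 (suc (suc i)) i≢1 = refl

  pow-cong : ∀ {a b} k → a ≗ b → pow a k ≗ pow b k
  pow-cong zero    a≗b = ≗-refl
  pow-cong (suc k) a≗b = ⊛-cong a≗b (pow-cong k a≗b)

  pow-+ : ∀ a i j → pow a (i +ℕ j) ≗ pow a i ⊛ pow a j
  pow-+ a zero    j = ≗-sym (one-⊛ (pow a j))
  pow-+ a (suc i) j = ≗-trans (⊛-congʳ a (pow-+ a i j)) (≗-sym (⊛-assoc a (pow a i) (pow a j)))

  pow-⊛ : ∀ a b k → pow (a ⊛ b) k ≗ pow a k ⊛ pow b k
  pow-⊛ a b zero    = ≗-sym (one-⊛ one)
  pow-⊛ a b (suc k) = ≗-trans (⊛-congʳ (a ⊛ b) (pow-⊛ a b k)) (⊛-interchange a b (pow a k) (pow b k))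

  pow-⊛-vanishes : ∀ c → c 0 ≡ + 0 → ∀ m b n → n < m → (pow c m ⊛ b) n ≡ + 0
  pow-⊛-vanishes c c0 (suc m) b n n<m = trans (⊛-assoc c (pow c m) b n) (sumTo-zero n term≡0)
    where
    term≡0 : ∀ i → i ≤ n → c i * (pow c m ⊛ b) (n ∸ i) ≡ + 0
    term≡0 zero    _ = cong (_* (pow c m ⊛ b) n) c0
    term≡0 (suc i) (s≤s {n = n′} i≤n′) =
      trans (cong (c (suc i) *_)
                  (pow-⊛-vanishes c c0 m b (n′ ∸ i) (≤-trans (s≤s (m∸n≤m n′ i)) (≤-pred n<m))))
            (*-zeroʳ (c (suc i)))

  pow-vanishes : ∀ c → c 0 ≡ + 0 → ∀ m n → n < m → pow c m n ≡ + 0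
  pow-vanishes c c0 m n n<m = trans (sym (⊛-one (pow c m) n)) (pow-⊛-vanishes c c0 m one n n<m)

  powX-⊛-+ : ∀ m j a → (pow X m ⊛ a) (m +ℕ j) ≡ a j
  powX-⊛-+ zero    j a = one-⊛ a j
  powX-⊛-+ (suc m) j a =
    trans (⊛-assoc X (pow X m) a (suc (m +ℕ j)))
          (trans (X-⊛-suc (pow X m ⊛ a) (m +ℕ j)) (powX-⊛-+ m j a))

  powX-⊛-∸ : ∀ i n a → i ≤ n → (pow X i ⊛ a) n ≡ a (n ∸ i)
  powX-⊛-∸ i n a i≤n = trans (cong (pow X i ⊛ a) (sym (m+[n∸m]≡n i≤n))) (powX-⊛-+ i (n ∸ i) a)

  ∘ₛ-cong : ∀ {a a′ c c′} → a ≗ a′ → c ≗ c′ → a ∘ₛ c ≗ a′ ∘ₛ c′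
  ∘ₛ-cong a≗a′ c≗c′ n = sumTo-cong n (λ k _ → cong₂ _*_ (a≗a′ k) (pow-cong k c≗c′ n))

  ∘ₛ-constant : ∀ a c → (a ∘ₛ c) 0 ≡ a 0
  ∘ₛ-constant a c = *-identityʳ (a 0)

  -- Column k of the Riordan array (E, c) is E c^k, so applying the array to the coefficient
  -- vector of G gives E · G(c).
  riordan-fundamental : ∀ c → c 0 ≡ + 0 → ∀ E G n →
    (E ⊛ (G ∘ₛ c)) n ≡ sumTo n (λ i → G i * riordan E c n i)
  riordan-fundamental c c0 E G n = begin
      sumTo n (λ j → E j * sumTo (n ∸ j) (λ i → G i * pow c i (n ∸ j)))
    ≡⟨ sumTo-cong n (λ j _ → *-distribˡ-sumTo (n ∸ j) (E j) _) ⟩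
      sumTo n (λ j → sumTo (n ∸ j) (λ i → E j * (G i * pow c i (n ∸ j))))
    ≡⟨ sumTo-cong n (λ j _ → sym (sumTo-extend (n ∸ j) n _ (m∸n≤m n j) (high-powers-vanish j))) ⟩
      sumTo n (λ j → sumTo n (λ i → E j * (G i * pow c i (n ∸ j))))
    ≡⟨ sumTo-comm n n _ ⟩
      sumTo n (λ i → sumTo n (λ j → E j * (G i * pow c i (n ∸ j))))
    ≡⟨ sumTo-cong n (λ i _ → trans (sumTo-cong n (λ j _ → pull (E j) (G i) (pow c i (n ∸ j))))
                                  (sym (*-distribˡ-sumTo n (G i) _))) ⟩
      sumTo n (λ i → G i * riordan E c n i) ∎
    where
    open ≡-Reasoning
    pull : ∀ x y z → x * (y * z) ≡ y * (x * z)
    pull = solve-∀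
    high-powers-vanish : ∀ j i → n ∸ j < i → E j * (G i * pow c i (n ∸ j)) ≡ + 0
    high-powers-vanish j i lt =
      trans (cong (λ z → E j * (G i * z)) (pow-vanishes c c0 i (n ∸ j) lt))
            (trans (cong (E j *_) (*-zeroʳ (G i))) (*-zeroʳ (E j)))

  one-∘ₛ : ∀ c → one ∘ₛ c ≗ one
  one-∘ₛ c n = trans (sumTo-single n 0 _ z≤n only-0) (*-identityˡ (one n))
    where
    only-0 : ∀ i → i ≢ 0 → one i * pow c i n ≡ + 0
    only-0 zero    i≢0 = ⊥-elim (i≢0 refl)
    only-0 (suc i) i≢0 = refl

  X-∘ₛ : ∀ c → c 0 ≡ + 0 → X ∘ₛ c ≗ c
  X-∘ₛ c c0 zero    = sym c0
  X-∘ₛ c c0 (suc n) =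
    trans (sumTo-single (suc n) 1 _ (s≤s z≤n) only-1) (trans (*-identityˡ _) (⊛-one c (suc n)))
    where
    only-1 : ∀ i → i ≢ 1 → X i * pow c i (suc n) ≡ + 0
    only-1 zero          i≢1 = refl
    only-1 (suc zero)    i≢1 = ⊥-elim (i≢1 refl)
    only-1 (suc (suc i)) i≢1 = refl

  ⊛-∘ₛ : ∀ a b c → c 0 ≡ + 0 → (a ⊛ b) ∘ₛ c ≗ (a ∘ₛ c) ⊛ (b ∘ₛ c)
  ⊛-∘ₛ a b c c0 n = begin
      sumTo n (λ k → sumTo k (λ i → a i * b (k ∸ i)) * pow c k n)
    ≡⟨ sumTo-cong n (λ k _ → *-distribʳ-sumTo k (pow c k n) _) ⟩
      sumTo n (λ k → sumTo k (λ i → a i * b (k ∸ i) * pow c k n))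
    ≡⟨ sumTo-cong n (λ k _ → sumTo-cong k (λ i i≤k →
         cong (λ z → a i * b (k ∸ i) * pow c z n) (sym (m+[n∸m]≡n i≤k)))) ⟩
      sumTo n (λ k → sumTo k (λ i → a i * b (k ∸ i) * pow c (i +ℕ (k ∸ i)) n))
    ≡⟨ sumTo-triangle n (λ i j → a i * b j * pow c (i +ℕ j) n) ⟩
      sumTo n (λ i → sumTo (n ∸ i) (λ j → a i * b j * pow c (i +ℕ j) n))
    ≡⟨ sumTo-cong n (λ i i≤n → sym (sumTo-extend (n ∸ i) n _ (m∸n≤m n i) (high-powers-vanish i i≤n))) ⟩
      sumTo n (λ i → sumTo n (λ j → a i * b j * pow c (i +ℕ j) n))
    ≡⟨ sumTo-comm n n _ ⟩
      sumTo n (λ j → sumTo n (λ i → a i * b j * pow c (i +ℕ j) n))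
    ≡⟨ sumTo-cong n (λ j _ → column j) ⟩
      sumTo n (λ j → b j * riordan (a ∘ₛ c) c n j)
    ≡⟨ sym (riordan-fundamental c c0 (a ∘ₛ c) b n) ⟩
      ((a ∘ₛ c) ⊛ (b ∘ₛ c)) n ∎
    where
    open ≡-Reasoning
    pull : ∀ x y z → x * y * z ≡ y * (x * z)
    pull = solve-∀
    high-powers-vanish : ∀ i → i ≤ n → ∀ j → n ∸ i < j → a i * b j * pow c (i +ℕ j) n ≡ + 0
    high-powers-vanish i i≤n j lt =
      trans (cong (a i * b j *_)
                  (pow-vanishes c c0 (i +ℕ j) n (subst (_< i +ℕ j) (m+[n∸m]≡n i≤n) (+-monoʳ-< i lt))))
            (*-zeroʳ (a i * b j))
    column : ∀ j → sumTo n (λ i → a i * b j * pow c (i +ℕ j) n) ≡ b j * riordan (a ∘ₛ c) c n j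
    column j = begin
        sumTo n (λ i → a i * b j * pow c (i +ℕ j) n)
      ≡⟨ sumTo-cong n (λ i _ → trans (pull (a i) (b j) _)
                                     (cong (λ z → b j * (a i * z))
                                           (trans (pow-+ c i j n) (⊛-comm (pow c i) (pow c j) n)))) ⟩
        sumTo n (λ i → b j * (a i * riordan (pow c j) c n i))
      ≡⟨ sym (*-distribˡ-sumTo n (b j) _) ⟩
        b j * sumTo n (λ i → a i * riordan (pow c j) c n i)
      ≡⟨ cong (b j *_) (sym (riordan-fundamental c c0 (pow c j) a n)) ⟩
        b j * (pow c j ⊛ (a ∘ₛ c)) n
      ≡⟨ cong (b j *_) (⊛-comm (pow c j) (a ∘ₛ c) n) ⟩
        b j * riordan (a ∘ₛ c) c n j ∎

  pow-∘ₛ : ∀ a c → c 0 ≡ + 0 → ∀ k → pow a k ∘ₛ c ≗ pow (a ∘ₛ c) k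
  pow-∘ₛ a c c0 zero    = one-∘ₛ c
  pow-∘ₛ a c c0 (suc k) = ≗-trans (⊛-∘ₛ a (pow a k) c c0) (⊛-congʳ (a ∘ₛ c) (pow-∘ₛ a c c0 k))

  ∘ₛ-linear : ∀ a c → (a ∘ₛ c) 1 ≡ a 1 * c 1
  ∘ₛ-linear a c =
    trans (cong₂ _+_ (*-zeroʳ (a 0)) (cong (a 1 *_) (⊛-one c 1))) (+-identityˡ (a 1 * c 1))

  riordan-mul : ∀ d c e h → c 0 ≡ + 0 → ∀ n k →
    matMul (riordan d c) (riordan e h) n k ≡ riordan (d ⊛ (e ∘ₛ c)) (h ∘ₛ c) n k
  riordan-mul d c e h c0 n k = begin
      sumTo n (λ j → riordan d c n j * riordan e h j k)
    ≡⟨ sumTo-cong n (λ j _ → *-comm (riordan d c n j) (riordan e h j k)) ⟩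
      sumTo n (λ j → (e ⊛ pow h k) j * riordan d c n j)
    ≡⟨ sym (riordan-fundamental c c0 d (e ⊛ pow h k) n) ⟩
      (d ⊛ ((e ⊛ pow h k) ∘ₛ c)) n
    ≡⟨ ⊛-congʳ d (≗-trans (⊛-∘ₛ e (pow h k) c c0) (⊛-congʳ (e ∘ₛ c) (pow-∘ₛ h c c0 k))) n ⟩
      (d ⊛ ((e ∘ₛ c) ⊛ pow (h ∘ₛ c) k)) n
    ≡⟨ sym (⊛-assoc d (e ∘ₛ c) (pow (h ∘ₛ c) k) n) ⟩
      riordan (d ⊛ (e ∘ₛ c)) (h ∘ₛ c) n k ∎
    where open ≡-Reasoning

  invUpTo-stable : ∀ a n m → m ≤ n → invUpTo a n m ≡ inv a m
  invUpTo-stable a n m m≤n with m≤n⇒∃[o]m+o≡n m≤n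
  ... | o , refl = stable o
    where
    stable : ∀ o → invUpTo a (m +ℕ o) m ≡ inv a m
    stable zero    = cong (λ k → invUpTo a k m) (+-identityʳ m)
    stable (suc o) rewrite +-suc m o with m ≟ suc (m +ℕ o)
    ... | yes m≡ = ⊥-elim (<⇒≢ (s≤s (m≤m+n m o)) m≡)
    ... | no  _  = stable o

  inv-suc : ∀ a n → inv a (suc n) ≡ - sum1To (suc n) (λ j → a j * invUpTo a n (suc n ∸ j))
  inv-suc a n with suc n ≟ suc n
  ... | yes _   = refl
  ... | no  n≢n = ⊥-elim (n≢n refl)

  ⊛-inv : ∀ a → a 0 ≡ + 1 → a ⊛ inv a ≗ one
  ⊛-inv a a0 zero    = cong (_* + 1) a0
  ⊛-inv a a0 (suc n) = begin
      (a ⊛ inv a) (suc n)     ≡⟨ sumTo≡head+sum1To (suc n) _ ⟩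
      a 0 * inv a (suc n) + S ≡⟨ cong₂ (λ x y → x * y + S) a0 (inv-suc a n) ⟩
      + 1 * (- S′) + S        ≡⟨ cong (λ z → + 1 * (- z) + S) (sum1To-cong (suc n) settled) ⟩
      + 1 * (- S) + S         ≡⟨ cancel S ⟩
      + 0                     ∎
    where
    open ≡-Reasoning
    S S′ : ℤ
    S  = sum1To (suc n) (λ j → a j * inv a (suc n ∸ j))
    S′ = sum1To (suc n) (λ j → a j * invUpTo a n (suc n ∸ j))
    settled : ∀ j → j < suc n → a (suc j) * invUpTo a n (n ∸ j) ≡ a (suc j) * inv a (n ∸ j)
    settled j _ = cong (a (suc j) *_) (invUpTo-stable a n (n ∸ j) (m∸n≤m n j))
    cancel : ∀ x → + 1 * (- x) + x ≡ + 0
    cancel = solve-∀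

  deriv-cong : ∀ {a b} → a ≗ b → deriv a ≗ deriv b
  deriv-cong a≗b n = cong (+ suc n *_) (a≗b (suc n))

  deriv-one : ∀ n → deriv one n ≡ + 0
  deriv-one n = *-zeroʳ (+ suc n)

  deriv-X : deriv X ≗ one
  deriv-X zero    = refl
  deriv-X (suc n) = *-zeroʳ (+ suc (suc n))

  -- Splitting the weight n + 1 of the term a_i b_{n+1-i} as i + (n + 1 - i).
  deriv-⊛ : ∀ a b → deriv (a ⊛ b) ≗ deriv a ⊛ b ⊕ a ⊛ deriv b
  deriv-⊛ a b n = begin
      + suc n * sumTo (suc n) t
    ≡⟨ *-distribˡ-sumTo (suc n) (+ suc n) t ⟩
      sumTo (suc n) (λ i → + suc n * t i)
    ≡⟨ sumTo-cong (suc n) (λ i i≤n → cong (_* t i) (trans (cong +_ (sym (m+[n∸m]≡n i≤n)))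
                                                           (pos-+ i (suc n ∸ i)))) ⟩
      sumTo (suc n) (λ i → (+ i + + (suc n ∸ i)) * t i)
    ≡⟨ sumTo-cong (suc n) (λ i _ → distrib (+ i) (+ (suc n ∸ i)) (t i)) ⟩
      sumTo (suc n) (λ i → + i * t i + + (suc n ∸ i) * t i)
    ≡⟨ sumTo-+ (suc n) _ _ ⟩
      sumTo (suc n) (λ i → + i * t i) + sumTo (suc n) (λ i → + (suc n ∸ i) * t i)
    ≡⟨ cong₂ _+_ left-weights right-weights ⟩
      (deriv a ⊛ b) n + (a ⊛ deriv b) n ∎
    where
    open ≡-Reasoning
    t : ℕ → ℤ
    t i = a i * b (suc n ∸ i)
    distrib : ∀ x y z → (x + y) * z ≡ x * z + y * z
    distrib = solve-∀
    reassoc : ∀ x y z → x * (y * z) ≡ x * y * z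
    reassoc = solve-∀
    pull : ∀ x y z → x * (y * z) ≡ y * (x * z)
    pull = solve-∀
    left-weights : sumTo (suc n) (λ i → + i * t i) ≡ (deriv a ⊛ b) n
    left-weights =
      trans (sumTo-head n _)
            (trans (+-identityˡ _) (sumTo-cong n (λ i _ → reassoc (+ suc i) (a (suc i)) (b (n ∸ i)))))
    weight : ∀ i m → m ≡ suc (n ∸ i) → + m * (a i * b m) ≡ a i * deriv b (n ∸ i)
    weight i .(suc (n ∸ i)) refl = pull (+ suc (n ∸ i)) (a i) (b (suc (n ∸ i)))
    right-weights : sumTo (suc n) (λ i → + (suc n ∸ i) * t i) ≡ (a ⊛ deriv b) n
    right-weights =
      trans (cong (λ z → sumTo n (λ i → + (suc n ∸ i) * t i) + z)
                  (trans (cong (λ m → + m * t (suc n)) (n∸n≡0 n)) (*-zeroˡ (t (suc n)))))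
            (trans (+ℤ-identityʳ _) (sumTo-cong n (λ i i≤n → weight i (suc n ∸ i) (+-∸-assoc 1 i≤n))))

  deriv-pow : ∀ a k → deriv (pow a (suc k)) ≗ scale (+ suc k) (pow a k ⊛ deriv a)
  deriv-pow a zero    n = trans (deriv-cong (⊛-one a) n) (sym (trans (*-identityˡ _) (one-⊛ (deriv a) n)))
  deriv-pow a (suc k) n = begin
      deriv (a ⊛ P) n
    ≡⟨ deriv-⊛ a P n ⟩
      (deriv a ⊛ P) n + (a ⊛ deriv P) n
    ≡⟨ cong₂ _+_ (⊛-comm (deriv a) P n) (⊛-congʳ a (deriv-pow a k) n) ⟩
      (P ⊛ deriv a) n + (a ⊛ scale (+ suc k) R) n
    ≡⟨ cong (λ z → (P ⊛ deriv a) n + z) scaled ⟩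
      (P ⊛ deriv a) n + + suc k * (P ⊛ deriv a) n
    ≡⟨ collect (+ suc k) ((P ⊛ deriv a) n) ⟩
      + suc (suc k) * (P ⊛ deriv a) n ∎
    where
    open ≡-Reasoning
    P R : FPS
    P = pow a (suc k)
    R = pow a k ⊛ deriv a
    scaled : (a ⊛ scale (+ suc k) R) n ≡ + suc k * (P ⊛ deriv a) n
    scaled =
      trans (⊛-comm a (scale (+ suc k) R) n)
            (trans (scale-⊛ (+ suc k) R a n)
                   (cong (+ suc k *_) (trans (⊛-comm R a n) (sym (⊛-assoc a (pow a k) (deriv a) n)))))
    collect : ∀ s q → q + s * q ≡ (+ 1 + s) * q
    collect = solve-∀

  pow-suc-coefficient : ∀ a n → pow a (suc n) (suc n) ≡ (deriv a ⊛ pow a n) n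
  pow-suc-coefficient a n =
    *-cancelˡ-≡ (+ suc n) _ _ (trans (deriv-pow a n n) (cong (+ suc n *_) (⊛-comm (pow a n) (deriv a) n)))

  deriv-∘ₛ : ∀ a c → c 0 ≡ + 0 → deriv (a ∘ₛ c) ≗ (deriv a ∘ₛ c) ⊛ deriv c
  deriv-∘ₛ a c c0 n = begin
      + suc n * sumTo (suc n) (λ k → a k * pow c k (suc n))
    ≡⟨ *-distribˡ-sumTo (suc n) (+ suc n) _ ⟩
      sumTo (suc n) (λ k → + suc n * (a k * pow c k (suc n)))
    ≡⟨ sumTo-cong (suc n) (λ k _ → pull (+ suc n) (a k) (pow c k (suc n))) ⟩
      sumTo (suc n) (λ k → a k * deriv (pow c k) n)
    ≡⟨ sumTo-head n _ ⟩
      a 0 * deriv one n + sumTo n (λ i → a (suc i) * deriv (pow c (suc i)) n)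
    ≡⟨ cong₂ _+_ (trans (cong (a 0 *_) (deriv-one n)) (*-zeroʳ (a 0)))
                 (sumTo-cong n (λ i _ → cong (a (suc i) *_) (deriv-pow c i n))) ⟩
      + 0 + sumTo n (λ i → a (suc i) * (+ suc i * (pow c i ⊛ deriv c) n))
    ≡⟨ +-identityˡ _ ⟩
      sumTo n (λ i → a (suc i) * (+ suc i * (pow c i ⊛ deriv c) n))
    ≡⟨ sumTo-cong n (λ i _ → trans (reassoc (a (suc i)) (+ suc i) _)
                                   (cong (deriv a i *_) (⊛-comm (pow c i) (deriv c) n))) ⟩
      sumTo n (λ i → deriv a i * riordan (deriv c) c n i)
    ≡⟨ sym (riordan-fundamental c c0 (deriv c) (deriv a) n) ⟩
      (deriv c ⊛ (deriv a ∘ₛ c)) n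
    ≡⟨ ⊛-comm (deriv c) (deriv a ∘ₛ c) n ⟩
      ((deriv a ∘ₛ c) ⊛ deriv c) n ∎
    where
    open ≡-Reasoning
    pull : ∀ x y z → x * (y * z) ≡ y * (x * z)
    pull = solve-∀
    reassoc : ∀ x y z → x * (y * z) ≡ y * x * z
    reassoc = solve-∀

module LagrangeInversion (f : FPS) (f0 : f 0 ≡ + 1) (φ : FPS) (φ0 : φ 0 ≡ + 0)
                         (φ-reverts : (X ⊛ inv f) ∘ₛ φ ≗ X) where

  open import Data.Nat using (zero; suc; _∸_; _≤_; s≤s; z≤n) renaming (_+_ to _+ℕ_; _*_ to _*ℕ_)
  open import Data.Nat.Properties using (+-comm) renaming (+-identityʳ to +ℕ-identityʳ)
  open import Data.Integer using (_*_)
  open import Data.Integer.Properties using (+-identityˡ; +-identityʳ; *-identityˡ; *-identityʳ; *-comm)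
  open import Relation.Binary.PropositionalEquality using (cong; cong₂; module ≡-Reasoning)
  open PowerSeries

  F W D : FPS
  F = f ∘ₛ φ
  W = deriv f ∘ₛ φ
  D = deriv φ ⊛ inv F

  F-constant : F 0 ≡ + 1
  F-constant = trans (∘ₛ-constant f φ) f0

  -- Compose f · (1/f) = 1 with φ, and use x = (x · 1/f)(φ) = φ · (1/f)(φ).
  φ≗X⊛F : φ ≗ X ⊛ F
  φ≗X⊛F = begin
      φ                           ≈⟨ ≗-sym (⊛-one φ) ⟩
      φ ⊛ one                     ≈⟨ ⊛-congʳ φ (≗-sym F⊛invf∘φ≗one) ⟩
      φ ⊛ (F ⊛ (inv f ∘ₛ φ))      ≈⟨ ⊛-congʳ φ (⊛-comm F (inv f ∘ₛ φ)) ⟩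
      φ ⊛ ((inv f ∘ₛ φ) ⊛ F)      ≈⟨ ≗-sym (⊛-assoc φ (inv f ∘ₛ φ) F) ⟩
      (φ ⊛ (inv f ∘ₛ φ)) ⊛ F      ≈⟨ ⊛-congˡ F φ⊛invf∘φ≗X ⟩
      X ⊛ F                       ∎
    where
    open ≗-Reasoning
    F⊛invf∘φ≗one : F ⊛ (inv f ∘ₛ φ) ≗ one
    F⊛invf∘φ≗one =
      ≗-trans (≗-sym (⊛-∘ₛ f (inv f) φ φ0)) (≗-trans (∘ₛ-cong (⊛-inv f f0) ≗-refl) (one-∘ₛ φ))
    φ⊛invf∘φ≗X : φ ⊛ (inv f ∘ₛ φ) ≗ X
    φ⊛invf∘φ≗X =
      ≗-trans (⊛-congˡ (inv f ∘ₛ φ) (≗-sym (X-∘ₛ φ φ0)))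
              (≗-trans (≗-sym (⊛-∘ₛ X (inv f) φ φ0)) φ-reverts)

  φ-linear : φ 1 ≡ + 1
  φ-linear = trans (φ≗X⊛F 1) (trans (X-⊛-suc F 0) F-constant)

  D-equation : D ≗ one ⊕ X ⊛ (W ⊛ D)
  D-equation = begin
      deriv φ ⊛ inv F                         ≈⟨ ⊛-congˡ (inv F) deriv-φ ⟩
      (F ⊕ X ⊛ (W ⊛ deriv φ)) ⊛ inv F         ≈⟨ ⊛-distribʳ-⊕ (inv F) F (X ⊛ (W ⊛ deriv φ)) ⟩
      F ⊛ inv F ⊕ (X ⊛ (W ⊛ deriv φ)) ⊛ inv F ≈⟨ ⊕-cong (⊛-inv F F-constant) regroup ⟩
      one ⊕ X ⊛ (W ⊛ D)                       ∎
    where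
    open ≗-Reasoning
    deriv-φ : deriv φ ≗ F ⊕ X ⊛ (W ⊛ deriv φ)
    deriv-φ = begin
      deriv φ                    ≈⟨ deriv-cong φ≗X⊛F ⟩
      deriv (X ⊛ F)              ≈⟨ deriv-⊛ X F ⟩
      deriv X ⊛ F ⊕ X ⊛ deriv F  ≈⟨ ⊕-cong (≗-trans (⊛-congˡ F deriv-X) (one-⊛ F))
                                          (⊛-congʳ X (deriv-∘ₛ f φ φ0)) ⟩
      F ⊕ X ⊛ (W ⊛ deriv φ)      ∎
    regroup : (X ⊛ (W ⊛ deriv φ)) ⊛ inv F ≗ X ⊛ (W ⊛ D)
    regroup = ≗-trans (⊛-assoc X (W ⊛ deriv φ) (inv F)) (⊛-congʳ X (⊛-assoc W (deriv φ) (inv F)))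

  D-constant : D 0 ≡ + 1
  D-constant = trans (D-equation 0) (+-identityʳ (+ 1))

  D-suc : ∀ n → D (suc n) ≡ (W ⊛ D) n
  D-suc n = trans (D-equation (suc n)) (trans (+-identityˡ _) (X-⊛-suc (W ⊛ D) n))

  riordanDφ-first-column : ∀ n → riordan D φ (suc n) 0 ≡ sumTo n (λ i → deriv f i * riordan D φ n i)
  riordanDφ-first-column n =
    trans (⊛-one D (suc n)) (trans (D-suc n) (trans (⊛-comm W D n) (riordan-fundamental φ φ0 D (deriv f) n)))

  riordanDφ-next : ∀ n m → riordan D φ (suc n) (suc m) ≡ sumTo n (λ i → f i * riordan D φ n (m +ℕ i))
  riordanDφ-next n m = begin
      (D ⊛ (φ ⊛ pow φ m)) (suc n)
    ≡⟨ ⊛-congʳ D (⊛-congˡ (pow φ m) φ≗X⊛F) (suc n) ⟩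
      (D ⊛ ((X ⊛ F) ⊛ pow φ m)) (suc n)
    ≡⟨ ⊛-permute D X F (pow φ m) (suc n) ⟩
      (X ⊛ ((D ⊛ pow φ m) ⊛ F)) (suc n)
    ≡⟨ X-⊛-suc ((D ⊛ pow φ m) ⊛ F) n ⟩
      ((D ⊛ pow φ m) ⊛ F) n
    ≡⟨ riordan-fundamental φ φ0 (D ⊛ pow φ m) f n ⟩
      sumTo n (λ i → f i * ((D ⊛ pow φ m) ⊛ pow φ i) n)
    ≡⟨ sumTo-cong n (λ i _ → cong (f i *_) (trans (⊛-assoc D (pow φ m) (pow φ i) n)
                                                  (⊛-congʳ D (≗-sym (pow-+ φ m i)) n))) ⟩
      sumTo n (λ i → f i * riordan D φ n (m +ℕ i)) ∎
    where open ≡-Reasoning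

  powers-first-column : ∀ n →
    (pow X 0 ⊛ pow f (suc n)) (suc n) ≡ sumTo n (λ i → deriv f i * (pow X i ⊛ pow f n) n)
  powers-first-column n =
    trans (one-⊛ (pow f (suc n)) (suc n))
          (trans (pow-suc-coefficient f n)
                 (sumTo-cong n (λ i i≤n → cong (deriv f i *_) (sym (powX-⊛-∸ i n (pow f n) i≤n)))))

  powers-next : ∀ n m →
    (pow X (suc m) ⊛ pow f (suc n)) (suc n) ≡ sumTo n (λ i → f i * (pow X (m +ℕ i) ⊛ pow f n) n)
  powers-next n m = begin
      ((X ⊛ pow X m) ⊛ (f ⊛ pow f n)) (suc n)
    ≡⟨ ⊛-interchange X (pow X m) f (pow f n) (suc n) ⟩
      ((X ⊛ f) ⊛ (pow X m ⊛ pow f n)) (suc n)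
    ≡⟨ ⊛-assoc X f (pow X m ⊛ pow f n) (suc n) ⟩
      (X ⊛ (f ⊛ (pow X m ⊛ pow f n))) (suc n)
    ≡⟨ X-⊛-suc (f ⊛ (pow X m ⊛ pow f n)) n ⟩
      sumTo n (λ i → f i * (pow X m ⊛ pow f n) (n ∸ i))
    ≡⟨ sumTo-cong n (λ i i≤n → cong (f i *_) (shift i i≤n)) ⟩
      sumTo n (λ i → f i * (pow X (m +ℕ i) ⊛ pow f n) n) ∎
    where
    open ≡-Reasoning
    shift : ∀ i → i ≤ n → (pow X m ⊛ pow f n) (n ∸ i) ≡ (pow X (m +ℕ i) ⊛ pow f n) n
    shift i i≤n = begin
        (pow X m ⊛ pow f n) (n ∸ i)
      ≡⟨ sym (powX-⊛-∸ i n (pow X m ⊛ pow f n) i≤n) ⟩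
        (pow X i ⊛ (pow X m ⊛ pow f n)) n
      ≡⟨ sym (⊛-assoc (pow X i) (pow X m) (pow f n) n) ⟩
        ((pow X i ⊛ pow X m) ⊛ pow f n) n
      ≡⟨ ⊛-congˡ (pow f n) (≗-sym (pow-+ X i m)) n ⟩
        (pow X (i +ℕ m) ⊛ pow f n) n
      ≡⟨ cong (λ j → (pow X j ⊛ pow f n) n) (+-comm i m) ⟩
        (pow X (m +ℕ i) ⊛ pow f n) n ∎

  lagrange : ∀ n m → riordan D φ n m ≡ (pow X m ⊛ pow f n) n
  lagrange zero    m       = trans (cong₂ _*_ D-constant (constant-term m))
                                   (trans (*-identityˡ _) (sym (*-identityʳ _)))
    where
    constant-term : ∀ m → pow φ m 0 ≡ pow X m 0
    constant-term zero    = refl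
    constant-term (suc m) =
      trans (pow-vanishes φ φ0 (suc m) 0 (s≤s z≤n)) (sym (pow-vanishes X refl (suc m) 0 (s≤s z≤n)))
  lagrange (suc n) zero    =
    trans (riordanDφ-first-column n)
          (trans (sumTo-cong n (λ i _ → cong (deriv f i *_) (lagrange n i))) (sym (powers-first-column n)))
  lagrange (suc n) (suc m) =
    trans (riordanDφ-next n m)
          (trans (sumTo-cong n (λ i _ → cong (f i *_) (lagrange n (m +ℕ i)))) (sym (powers-next n m)))

  diagonal≡product : ∀ g n k →
    riordan g (X ⊛ f) (2 *ℕ n) (n +ℕ k) ≡ matMul (riordan D φ) (riordan g (X ⊛ f)) n k
  diagonal≡product g n k = begin
      (g ⊛ pow (X ⊛ f) (n +ℕ k)) (n +ℕ (n +ℕ 0))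
    ≡⟨ cong (λ z → (g ⊛ pow (X ⊛ f) (n +ℕ k)) (n +ℕ z)) (+ℕ-identityʳ n) ⟩
      (g ⊛ pow (X ⊛ f) (n +ℕ k)) (n +ℕ n)
    ≡⟨ ⊛-congʳ g (≗-trans (pow-+ (X ⊛ f) n k) (⊛-congˡ (pow (X ⊛ f) k) (pow-⊛ X f n))) (n +ℕ n) ⟩
      (g ⊛ ((pow X n ⊛ pow f n) ⊛ pow (X ⊛ f) k)) (n +ℕ n)
    ≡⟨ ⊛-permute g (pow X n) (pow f n) (pow (X ⊛ f) k) (n +ℕ n) ⟩
      (pow X n ⊛ (column ⊛ pow f n)) (n +ℕ n)
    ≡⟨ powX-⊛-+ n n (column ⊛ pow f n) ⟩
      (column ⊛ pow f n) n
    ≡⟨ sumTo-cong n (λ j j≤n → trans (*-comm (column j) (pow f n (n ∸ j)))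
                                     (cong (_* column j) (coefficient j j≤n))) ⟩
      sumTo n (λ j → riordan D φ n j * column j) ∎
    where
    open ≡-Reasoning
    column : FPS
    column = g ⊛ pow (X ⊛ f) k
    coefficient : ∀ j → j ≤ n → pow f n (n ∸ j) ≡ riordan D φ n j
    coefficient j j≤n = trans (sym (powX-⊛-∸ j n (pow f n) j≤n)) (sym (lagrange n j))

  diagonal-riordan : ∀ g n k →
    riordan g (X ⊛ f) (2 *ℕ n) (n +ℕ k) ≡ riordan (D ⊛ (g ∘ₛ φ)) ((X ⊛ f) ∘ₛ φ) n k
  diagonal-riordan g n k = trans (diagonal≡product g n k) (riordan-mul D φ g (X ⊛ f) φ0 n k)

  D⊛g∘φ-constant : ∀ g → g 0 ≡ + 1 → (D ⊛ (g ∘ₛ φ)) 0 ≡ + 1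
  D⊛g∘φ-constant g g0 = cong₂ _*_ D-constant (trans (∘ₛ-constant g φ) g0)

  X⊛f∘φ-linear : ((X ⊛ f) ∘ₛ φ) 1 ≡ + 1
  X⊛f∘φ-linear = trans (∘ₛ-linear (X ⊛ f) φ) (cong₂ _*_ (trans (X-⊛-suc f 0) f0) φ-linear)

open import Data.Nat using (ℕ; _+_; _*_)
open import Data.Product using (_×_; Σ-syntax; _,_)

≡1⇒≢0 : {x : ℤ} → x ≡ + 1 → x ≢ + 0
≡1⇒≢0 refl ()

mainTheorem1 : (g f : FPS) → g 0 ≡ + 1 → f 0 ≡ + 1 →
    (φ : FPS) → IsReversionOf φ (X ⊛ inv f) →
    (Σ[ d ∈ FPS ] Σ[ h ∈ FPS ] (d 0 ≢ + 0) × (h 0 ≡ + 0) × (h 1 ≢ + 0) ×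
       (∀ n k → riordan g (X ⊛ f) (2 * n) (n + k) ≡ riordan d h n k))
    × (∀ n k → riordan g (X ⊛ f) (2 * n) (n + k)
         ≡ matMul (riordan (deriv φ ⊛ inv (f ∘ₛ φ)) φ) (riordan g (X ⊛ f)) n k)
mainTheorem1 g f g0 f0 φ (φ0 , φ-reverts) =
  ( D ⊛ (g ∘ₛ φ) , (X ⊛ f) ∘ₛ φ
  , ≡1⇒≢0 (D⊛g∘φ-constant g g0)
  , ∘ₛ-constant (X ⊛ f) φ
  , ≡1⇒≢0 X⊛f∘φ-linear
  , diagonal-riordan g )
  , diagonal≡product g
  where
  open PowerSeries using (∘ₛ-constant)
  open LagrangeInversion f f0 φ φ0 φ-reverts
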